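{- Let $\mathcal{L}$ be the category whose objects are natural numbers and whose morphisms $m\to n$ are the total injective increasing functions $[m]\to[n]$, let $\mathcal{G}$ be its full subcategory on the objects $1$ and $2$, and $I:\mathcal{G}\to\mathcal{L}$ the inclusion. A presheaf $P\in\hat{\mathcal{L}}$ preserves finite limits (i.e. sends the colimiting cocone of every finite diagram in $\mathcal{L}$ that admits a colimit to a limiting cone in $\mathrm{Set}$) if and only if, for every finite graph $G\in\hat{\mathcal{G}}$ such that the diagram $I\circ\pi_G:\mathrm{El}(G)\to\mathcal{L}$ admits a colimit in $\mathcal{L}$, $P$ sends the colimit of this diagram to a limit in $\mathrm{Set}$.
   Context: For $n\in\mathbb{N}$ write $[n]=\{0,\dots,n-1\}$; for $n\in\mathbb{N}$ and $i\in[n+1]$, $s^n_i:n\to n+1$ is the increasing injection with image $[n+1]\setminus\{i\}$. The only non-identity morphisms of $\mathcal{G}$ are $s^1_0,s^1_1:1\to2$, so a presheaf $G\in\hat{\mathcal{G}}=\mathrm{Set}^{\mathcal{G}^{op}}$ is a graph with vertex set $G(1)$, edge set $G(2)$, source map $G(s^1_1)$ and target map $G(s^1_0)$; it is finite if $G(1)$ and $G(2)$ are finite. The category of elements $\mathrm{El}(G)$ has objects pairs $(k,x)$ with $k\in\{1,2\}$, $x\in G(k)$, and morphisms $(k,x)\to(k',x')$ the morphisms $u:k\to k'$ of $\mathcal{G}$ with $G(u)(x')=x$; $\pi_G:\mathrm{El}(G)\to\mathcal{G}$ is the first projection. -}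

module Defs where

open import Data.Nat as ℕ using (ℕ; zero; suc; s≤s; z≤n)
open import Data.Fin as Fin using (Fin; zero; suc; punchIn)
open import Data.Sum using (_⊎_)
open import Data.Product using (Σ; _×_; _,_)
open import Function.Bundles using (_↔_)
open import Relation.Binary.PropositionalEquality using (_≡_; refl)

-- The category 𝓛: objects ℕ, morphisms m → n are the (total) injective
-- increasing, i.e. strictly increasing, functions [m] → [n].

record Inc (m n : ℕ) : Set where
  field
    fun  : Fin m → Fin n
    mono : ∀ {i j : Fin m} → i Fin.< j → fun i Fin.< fun j
open Inc public

_≈_ : ∀ {m n} → Inc m n → Inc m n → Set
f ≈ g = ∀ i → fun f i ≡ fun g i
infix 4 _≈_

idI : ∀ n → Inc n n
idI n = record { fun = λ i → i ; mono = λ p → p }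

_∘I_ : ∀ {l m n} → Inc m n → Inc l m → Inc l n
g ∘I f = record { fun = λ i → fun g (fun f i) ; mono = λ p → mono g (mono f p) }
infixr 9 _∘I_

punchIn-mono-< : ∀ {n} (i : Fin (suc n)) (j k : Fin n) →
                 j Fin.< k → punchIn i j Fin.< punchIn i k
punchIn-mono-< zero    j       k       p       = s≤s p
punchIn-mono-< (suc i) zero    (suc k) p       = s≤s z≤n
punchIn-mono-< (suc i) (suc j) (suc k) (s≤s p) = s≤s (punchIn-mono-< i j k p)

s : ∀ n → Fin (suc n) → Inc n (suc n)
s n i = record { fun = punchIn i ; mono = λ {j} {k} p → punchIn-mono-< i j k p }

record Presheaf : Set₁ where
  field
    F₀    : ℕ → Set
    F₁    : ∀ {m n} → Inc m n → F₀ n → F₀ m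
    F-resp : ∀ {m n} {f g : Inc m n} → f ≈ g → ∀ x → F₁ f x ≡ F₁ g x
    F-id  : ∀ {n} x → F₁ (idI n) x ≡ x
    F-∘   : ∀ {l m n} (f : Inc l m) (g : Inc m n) x → F₁ (g ∘I f) x ≡ F₁ f (F₁ g x)
open Presheaf public

record Cat : Set₁ where
  field
    Obj   : Set
    Hom   : Obj → Obj → Set
    idC   : ∀ a → Hom a a
    _∘C_  : ∀ {a b c} → Hom b c → Hom a b → Hom a c
    idˡ   : ∀ {a b} (f : Hom a b) → idC b ∘C f ≡ f
    idʳ   : ∀ {a b} (f : Hom a b) → f ∘C idC a ≡ f
    assoc : ∀ {a b c d} (f : Hom a b) (g : Hom b c) (h : Hom c d) →
            (h ∘C g) ∘C f ≡ h ∘C (g ∘C f)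
open Cat public

IsFinite : Cat → Set
IsFinite J = Σ ℕ (λ n → Obj J ↔ Fin n) × (∀ a b → Σ ℕ (λ k → Hom J a b ↔ Fin k))

record Diagram (J : Cat) : Set where
  field
    ob     : Obj J → ℕ
    hom    : ∀ {a b} → Hom J a b → Inc (ob a) (ob b)
    hom-id : ∀ a → hom (idC J a) ≈ idI (ob a)
    hom-∘  : ∀ {a b c} (f : Hom J a b) (g : Hom J b c) →
             hom (_∘C_ J g f) ≈ hom g ∘I hom f
open Diagram public

record Cocone {J : Cat} (D : Diagram J) : Set where
  field
    apex : ℕ
    leg  : ∀ a → Inc (ob D a) apex
    comm : ∀ {a b} (f : Hom J a b) → leg b ∘I hom D f ≈ leg a
open Cocone public

IsColimit : ∀ {J : Cat} {D : Diagram J} → Cocone D → Set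
IsColimit {J} {D} K =
  (K' : Cocone D) →
    Σ (Inc (apex K) (apex K')) (λ u → ∀ a → u ∘I leg K a ≈ leg K' a)
    × (∀ (u v : Inc (apex K) (apex K')) →
         (∀ a → u ∘I leg K a ≈ leg K' a) →
         (∀ a → v ∘I leg K a ≈ leg K' a) → u ≈ v)

SendsToLimit : Presheaf → ∀ {J : Cat} {D : Diagram J} → Cocone D → Set₁
SendsToLimit P {J} {D} K =
  (X : Set) (x : ∀ a → X → F₀ P (ob D a)) →
  (∀ {a b} (f : Hom J a b) (y : X) → F₁ P (hom D f) (x b y) ≡ x a y) →
    Σ (X → F₀ P (apex K)) (λ u → ∀ a y → F₁ P (leg K a) (u y) ≡ x a y)
    × (∀ (u v : X → F₀ P (apex K)) →
         (∀ a y → F₁ P (leg K a) (u y) ≡ x a y) →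
         (∀ a y → F₁ P (leg K a) (v y) ≡ x a y) → ∀ y → u y ≡ v y)

PreservesFiniteLimits : Presheaf → Set₁
PreservesFiniteLimits P =
  (J : Cat) → IsFinite J → (D : Diagram J) → (K : Cocone D) → IsColimit K →
  SendsToLimit P K

-- Finite graphs (finite presheaves on 𝓖), with vertices Fin nV, edges
-- Fin nE, source map G(s^1_1) = src, target map G(s^1_0) = tgt.

record FinGraph : Set where
  field
    nV  : ℕ
    nE  : ℕ
    src : Fin nE → Fin nV
    tgt : Fin nE → Fin nV
open FinGraph public

module _ (G : FinGraph) where
  -- objects of El(G): (1, v) and (2, e)
  data ElObj : Set where
    vtx : Fin (nV G) → ElObj
    edg : Fin (nE G) → ElObj

  -- morphisms of El(G): identities, s^1_1 : (1, src e) → (2, e),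
  -- s^1_0 : (1, tgt e) → (2, e)
  data ElHom : ElObj → ElObj → Set where
    idV  : ∀ v → ElHom (vtx v) (vtx v)
    idE  : ∀ e → ElHom (edg e) (edg e)
    s11M : ∀ e → ElHom (vtx (src G e)) (edg e)
    s10M : ∀ e → ElHom (vtx (tgt G e)) (edg e)

  elId : ∀ a → ElHom a a
  elId (vtx v) = idV v
  elId (edg e) = idE e

  elComp : ∀ {a b c} → ElHom b c → ElHom a b → ElHom a c
  elComp (idV _) f = f
  elComp (idE _) f = f
  elComp (s11M e) (idV _) = s11M e
  elComp (s10M e) (idV _) = s10M e

  elIdʳ : ∀ {a b} (f : ElHom a b) → elComp f (elId a) ≡ f
  elIdʳ (idV v) = refl
  elIdʳ (idE e) = refl
  elIdʳ (s11M e) = refl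
  elIdʳ (s10M e) = refl

  elIdˡ : ∀ {a b} (f : ElHom a b) → elComp (elId b) f ≡ f
  elIdˡ (idV v) = refl
  elIdˡ (idE e) = refl
  elIdˡ (s11M e) = refl
  elIdˡ (s10M e) = refl

  elAssoc : ∀ {a b c d} (f : ElHom a b) (g : ElHom b c) (h : ElHom c d) →
            elComp (elComp h g) f ≡ elComp h (elComp g f)
  elAssoc f g (idV _) = refl
  elAssoc f g (idE _) = refl
  elAssoc (idV _) (idV _) (s11M e) = refl
  elAssoc (idV _) (idV _) (s10M e) = refl

  El : Cat
  El = record
    { Obj = ElObj ; Hom = ElHom ; idC = elId ; _∘C_ = elComp
    ; idˡ = elIdˡ ; idʳ = elIdʳ ; assoc = elAssoc }

  elOb : ElObj → ℕ
  elOb (vtx _) = 1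
  elOb (edg _) = 2

  elHom : ∀ {a b} → ElHom a b → Inc (elOb a) (elOb b)
  elHom (idV _)  = idI 1
  elHom (idE _)  = idI 2
  elHom (s11M _) = s 1 (suc zero)
  elHom (s10M _) = s 1 zero

  elHom-id : ∀ a → elHom (elId a) ≈ idI (elOb a)
  elHom-id (vtx _) i = refl
  elHom-id (edg _) i = refl

  elHom-∘ : ∀ {a b c} (f : ElHom a b) (g : ElHom b c) →
            elHom (elComp g f) ≈ elHom g ∘I elHom f
  elHom-∘ f (idV _) i = refl
  elHom-∘ f (idE _) i = refl
  elHom-∘ (idV _) (s11M e) i = refl
  elHom-∘ (idV _) (s10M e) i = refl

  IπG : Diagram El
  IπG = record { ob = elOb ; hom = elHom ; hom-id = elHom-id ; hom-∘ = elHom-∘ }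

module Submission where

-- Lemma 11: a presheaf P on 𝓛 preserves finite limits iff it sends the
-- colimit of I ∘ π_G to a limit for every finite graph G for which it exists.
-- (⇒) is the special case of the finite categories El(G).
-- (⇐) Let K, with apex n, be a colimit of a finite diagram D in 𝓛.  Every
-- point v of [n] is hit by a leg, and the objects hitting v are connected
-- by morphisms of J (else choosing the face s_v or s_{v+1} per component
-- gives a cocone with no factorisation).  So a compatible family x has a
-- well-defined value at each point of [n], and values along the images of
-- the pairs p < q of the objects of D; these form a graph G_D on [n] with
-- colimit n, so P glues them to some z ∈ P(n).  It restricts to x since P
-- also sends the complete graph on [k] to a limit, i.e. points and pairs
-- detect elements of P(k).

open import Defs
open import Data.Nat using (ℕ; zero; suc; _+_; s≤s; z≤n)
open import Data.Fin as Fin using (Fin; zero; suc; punchIn; inject₁)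
open import Data.Fin.Properties
  using (_≟_; any?; ¬Fin0; +↔⊎; <-cmp; <-irrefl; suc-injective)
open import Data.Sum using (_⊎_; inj₁; inj₂)
open import Data.Product using (Σ; Σ-syntax; _×_; _,_; proj₁; proj₂)
open import Data.Unit using (⊤; tt)
open import Data.Empty using (⊥-elim)
open import Data.List using (List; []; _∷_; length; lookup; map; _++_; allFin; concatMap; cartesianProduct)
open import Data.List.Membership.Propositional using (_∈_)
open import Data.List.Membership.Propositional.Properties
  using (∈-map⁺; ∈-++⁺ˡ; ∈-++⁺ʳ; ∈-allFin; ∈-cartesianProduct⁺; ∈-concatMap⁺)
open import Data.List.Relation.Unary.Any as Any using (here; there; index)
open import Data.List.Relation.Unary.Any.Properties using (lookup-index)
open import Data.Sum.Function.Propositional using (_⊎-↔_)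
open import Function using (_∘_; id)
open import Function.Bundles using (_↔_; _⇔_; mk⇔; mk↔ₛ′; Inverse)
open import Function.Properties.Inverse using (↔-sym; ↔-trans)
open import Relation.Binary using (DecidableEquality; tri<; tri≈; tri>)
open import Relation.Binary.Construct.Closure.Equivalence using (EqClosure; symmetric)
open import Relation.Binary.Construct.Closure.Symmetric using (fwd; bwd)
open import Relation.Binary.Construct.Closure.ReflexiveTransitive using (ε; _◅_; _◅◅_)
open import Relation.Nullary using (Dec; yes; no; ¬_; Irrelevant)
open import Relation.Nullary.Decidable using (map′; _×-dec_)
open import Axiom.UniquenessOfIdentityProofs using (module Decidable⇒UIP)
open import Relation.Binary.PropositionalEquality

point : ∀ {k} → Fin k → Inc 1 k
point p = record { fun = λ _ → p ; mono = λ { {zero} {zero} () } }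

Pair : ℕ → Set
Pair k = Σ[ p ∈ Fin k ] Σ[ q ∈ Fin k ] p Fin.< q

lower upper : ∀ {k} → Pair k → Fin k
lower = proj₁
upper = proj₁ ∘ proj₂

edgeMap : ∀ {k} → Pair k → Inc 2 k
edgeMap t = record { fun = ends ; mono = increasing }
  where
  ends : Fin 2 → Fin _
  ends zero    = lower t
  ends (suc _) = upper t
  increasing : ∀ {i j : Fin 2} → i Fin.< j → ends i Fin.< ends j
  increasing {zero}     {suc zero} _       = proj₂ (proj₂ t)
  increasing {suc zero} {suc zero} (s≤s ())

mapPair : ∀ {m k} → Inc m k → Pair m → Pair k
mapPair f t = fun f (lower t) , fun f (upper t) , mono f (proj₂ (proj₂ t))

pairs : ∀ k → List (Pair k)
pairs zero    = []
pairs (suc k) = map (λ q → zero , suc q , s≤s z≤n) (allFin k) ++ map shift (pairs k)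
  where
  shift : Pair k → Pair (suc k)
  shift t = suc (lower t) , suc (upper t) , s≤s (proj₂ (proj₂ t))

∈-pairs : ∀ {k} (t : Pair k) → t ∈ pairs k
∈-pairs {suc k} (zero  , suc q , s≤s z≤n) = ∈-++⁺ˡ (∈-map⁺ _ (∈-allFin q))
∈-pairs {suc k} (suc p , suc q , s≤s p<q) = ∈-++⁺ʳ _ (∈-map⁺ _ (∈-pairs (p , q , p<q)))

Inc-injective : ∀ {m k} (f : Inc m k) {i j} → fun f i ≡ fun f j → i ≡ j
Inc-injective f {i} {j} eq with <-cmp i j
... | tri< i<j _ _ = ⊥-elim (<-irrefl eq (mono f i<j))
... | tri≈ _ i≡j _ = i≡j
... | tri> _ _ j<i = ⊥-elim (<-irrefl (sym eq) (mono f j<i))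

faces-agree : ∀ {n} {v w : Fin n} → w ≢ v → punchIn (inject₁ v) w ≡ punchIn (suc v) w
faces-agree {v = zero}  {zero}  w≢v = ⊥-elim (w≢v refl)
faces-agree {v = suc v} {zero}  w≢v = refl
faces-agree {v = zero}  {suc w} w≢v = refl
faces-agree {v = suc v} {suc w} w≢v = cong suc (faces-agree (w≢v ∘ cong suc))

faces-differ : ∀ {n} (v : Fin n) → punchIn (inject₁ v) v ≢ punchIn (suc v) v
faces-differ zero    ()
faces-differ (suc v) eq = faces-differ v (suc-injective eq)

chooseFace : ∀ {n} {A : Set} → Fin n → Dec A → Fin (suc n)
chooseFace v (yes _) = suc v
chooseFace v (no _)  = inject₁ v

chooseFace-yes : ∀ {n} {A : Set} (v : Fin n) → A → (d : Dec A) → chooseFace v d ≡ suc v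
chooseFace-yes v a (yes _) = refl
chooseFace-yes v a (no ¬a) = ⊥-elim (¬a a)

chooseFace-no : ∀ {n} {A : Set} (v : Fin n) → ¬ A → (d : Dec A) → chooseFace v d ≡ inject₁ v
chooseFace-no v ¬a (yes a) = ⊥-elim (¬a a)
chooseFace-no v ¬a (no _)  = refl

chooseFace-resp : ∀ {n} {A B : Set} (v : Fin n) → (A → B) × (B → A) →
                  (dA : Dec A) (dB : Dec B) → chooseFace v dA ≡ chooseFace v dB
chooseFace-resp v _         (yes _) (yes _) = refl
chooseFace-resp v (a→b , _) (yes a) (no ¬b) = ⊥-elim (¬b (a→b a))
chooseFace-resp v (_ , b→a) (no ¬a) (yes b) = ⊥-elim (¬a (b→a b))
chooseFace-resp v _         (no _)  (no _)  = refl

chooseFace-off : ∀ {n} {A : Set} {v w : Fin n} (d : Dec A) → w ≢ v →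
                 punchIn (chooseFace v d) w ≡ punchIn (inject₁ v) w
chooseFace-off (yes _) w≢v = sym (faces-agree w≢v)
chooseFace-off (no _)  w≢v = refl

-- Limits in Set as unique amalgamation

restrict-∘ : ∀ (P : Presheaf) {l m k} {h : Inc l k} (f : Inc l m) (g : Inc m k) →
             h ≈ g ∘I f → ∀ z → F₁ P h z ≡ F₁ P f (F₁ P g z)
restrict-∘ P f g h≈g∘f z = trans (F-resp P h≈g∘f z) (F-∘ P f g z)

module _ (P : Presheaf) {J : Cat} {D : Diagram J} where

  -- Compatible families: the elements of the limit of P ∘ Dᵒᵖ.
  Compatible : (∀ a → F₀ P (ob D a)) → Set
  Compatible x = ∀ {a b} (f : Hom J a b) → F₁ P (hom D f) (x b) ≡ x a

  module _ (K : Cocone D) where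

    Restricts : F₀ P (apex K) → (∀ a → F₀ P (ob D a)) → Set
    Restricts z x = ∀ a → F₁ P (leg K a) z ≡ x a

    restrictions-compatible : ∀ z → Compatible (λ a → F₁ P (leg K a) z)
    restrictions-compatible z f =
      trans (sym (F-∘ P (hom D f) (leg K _) z)) (F-resp P (comm K f) z)

    UniqueAmalgam : (∀ a → F₀ P (ob D a)) → Set
    UniqueAmalgam x = Σ (F₀ P (apex K)) (λ z → Restricts z x)
                      × (∀ z z' → Restricts z x → Restricts z' x → z ≡ z')

    UniqueAmalgamation : Set
    UniqueAmalgamation = ∀ x → Compatible x → UniqueAmalgam x

    -- A cone is a limit in Set iff it has unique amalgamation, since
    -- cones with vertex X are X-indexed families of compatible families.
    limit⇒amalgamation : SendsToLimit P K → UniqueAmalgamation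
    limit⇒amalgamation lim x compatible with lim ⊤ (λ a _ → x a) (λ f _ → compatible f)
    ... | (glued , restricts) , unique =
      (glued tt , λ a → restricts a tt) ,
      λ z z' hz hz' → unique (λ _ → z) (λ _ → z') (λ a _ → hz a) (λ a _ → hz' a) tt

    amalgamation⇒limit : UniqueAmalgamation → SendsToLimit P K
    amalgamation⇒limit amalgamate X x compatible =
      ((λ y → proj₁ (proj₁ (at y))) , λ a y → proj₂ (proj₁ (at y)) a) ,
      λ u w hu hw y → proj₂ (at y) (u y) (w y) (λ a → hu a y) (λ a → hw a y)
      where
      at : (y : X) → UniqueAmalgam (λ a → x a y)
      at y = amalgamate (λ a → x a y) (λ f → compatible f y)

    restrictions-injective : UniqueAmalgamation → ∀ z z' →
      (∀ a → F₁ P (leg K a) z ≡ F₁ P (leg K a) z') → z ≡ z'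
    restrictions-injective amalgamate z z' same =
      proj₂ (amalgamate _ (restrictions-compatible z')) z z' same (λ a → refl)

-- Colimiting cocones in 𝓛

module ColimitFacts {J : Cat} {D : Diagram J} (K : Cocone D) (colim : IsColimit K) where

  private
    n : ℕ
    n = apex K
    L : ∀ a → Inc (ob D a) n
    L = leg K

  legs-jointly-epi : ∀ {m} (u w : Inc n m) → (∀ a → u ∘I L a ≈ w ∘I L a) → u ≈ w
  legs-jointly-epi u w agree =
    proj₂ (colim uK) u w (λ a i → refl) (λ a i → sym (agree a i))
    where
    uK : Cocone D
    uK = record { apex = _ ; leg = λ a → u ∘I L a
                ; comm = λ f i → cong (fun u) (comm K f i) }

  Hits : Fin n → Obj J → Set
  Hits v a = Σ[ p ∈ Fin (ob D a) ] fun (L a) p ≡ v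

  hits? : ∀ v a → Dec (Hits v a)
  hits? v a = any? (λ p → fun (L a) p ≟ v)

  hits-along : ∀ {v a b} → Hom J a b → Hits v a → Hits v b
  hits-along f (p , Lp≡v) = fun (hom D f) p , trans (comm K f p) Lp≡v

  -- Every point is hit: otherwise the faces s_v and s_{v+1} would be two
  -- different factorisations of the same cocone.
  every-point-hit : ∀ v → ¬ (∀ a → ¬ Hits v a)
  every-point-hit v missed =
    faces-differ v (legs-jointly-epi (s n (inject₁ v)) (s n (suc v))
      (λ a p → faces-agree (λ Lp≡v → missed a (p , Lp≡v))) v)

  -- A decidable property of objects that is invariant along the morphisms
  -- leaving objects that hit v holds for all or none of the objects hitting
  -- v: otherwise choosing the face s_v or s_{v+1} according to the property
  -- gives a cocone admitting no factorisation.
  separate : ∀ v (Q : Obj J → Set) → (∀ a → Dec (Q a)) →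
             (∀ {a b} → Hom J a b → Hits v a → (Q a → Q b) × (Q b → Q a)) →
             ∀ {a b} → Hits v a → Hits v b → Q a → Q b
  separate v Q Q? invariant {a} {b} ha hb qa with Q? b
  ... | yes qb = qb
  ... | no ¬qb = ⊥-elim (faces-differ v (begin
    punchIn (inject₁ v) v           ≡⟨ cong (λ i → punchIn i v) (sym (chooseFace-no v ¬qb (Q? b))) ⟩
    punchIn (chooseFace v (Q? b)) v ≡⟨ sym (mediator-at hb) ⟩
    fun (proj₁ mediator) v          ≡⟨ mediator-at ha ⟩
    punchIn (chooseFace v (Q? a)) v ≡⟨ cong (λ i → punchIn i v) (chooseFace-yes v qa (Q? a)) ⟩
    punchIn (suc v) v               ∎))
    where
    open ≡-Reasoning

    legQ : ∀ c → Inc (ob D c) (suc n)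
    legQ c = s n (chooseFace v (Q? c)) ∘I L c

    commQ : ∀ {c d} (f : Hom J c d) → legQ d ∘I hom D f ≈ legQ c
    commQ {c} {d} f r with fun (L c) r ≟ v
    ... | yes Lr≡v = trans (cong (punchIn (chooseFace v (Q? d))) (comm K f r))
                           (cong (λ i → punchIn i (fun (L c) r))
                                 (sym (chooseFace-resp v (invariant f (r , Lr≡v)) (Q? c) (Q? d))))
    ... | no  Lr≢v = trans (cong (punchIn (chooseFace v (Q? d))) (comm K f r))
                           (trans (chooseFace-off (Q? d) Lr≢v) (sym (chooseFace-off (Q? c) Lr≢v)))

    mediator : Σ (Inc n (suc n)) (λ u → ∀ c → u ∘I L c ≈ legQ c)
    mediator = proj₁ (colim record { apex = suc n ; leg = legQ ; comm = commQ })

    mediator-at : ∀ {c} → Hits v c → fun (proj₁ mediator) v ≡ punchIn (chooseFace v (Q? c)) v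
    mediator-at {c} (p , Lp≡v) =
      trans (cong (fun (proj₁ mediator)) (sym Lp≡v))
            (trans (proj₂ mediator c p) (cong (punchIn (chooseFace v (Q? c))) Lp≡v))

-- Connected components by union–find

-- Processing a list of candidate pairs once, and merging the classes of
-- the related ones, labels every element so that related pairs of the
-- list get equal labels and equal labels only occur within one class of
-- the equivalence relation generated by R.
module UnionFind {A : Set} (_≟A_ : DecidableEquality A)
                 (R : A → A → Set) (R? : ∀ a b → Dec (R a b)) where

  Labelling : Set
  Labelling = A → A

  relabel : A → A → A → A
  relabel new old ℓ with ℓ ≟A old
  ... | yes _ = new
  ... | no  _ = ℓ

  merge : A → A → Labelling → Labelling
  merge i j lab z = relabel (lab i) (lab j) (lab z)

  step : A × A → Labelling → Labelling
  step (i , j) lab with R? i j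
  ... | yes _ = merge i j lab
  ... | no  _ = lab

  run : List (A × A) → Labelling → Labelling
  run []       lab = lab
  run (p ∷ ps) lab = run ps (step p lab)

  Sound : Labelling → Set
  Sound lab = ∀ a b → lab a ≡ lab b → EqClosure R a b

  merge-sound : ∀ {i j} lab → R i j → Sound lab → Sound (merge i j lab)
  merge-sound {i} {j} lab r sound a b eq with lab a ≟A lab j | lab b ≟A lab j
  ... | yes a~j | yes b~j = sound a b (trans a~j (sym b~j))
  ... | yes a~j | no  _   = sound a j a~j ◅◅ bwd r ◅ sound i b eq
  ... | no  _   | yes b~j = sound a i eq ◅◅ fwd r ◅ symmetric R (sound b j b~j)
  ... | no  _   | no  _   = sound a b eq

  run-sound : ∀ ps lab → Sound lab → Sound (run ps lab)
  run-sound []             lab sound = sound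
  run-sound ((i , j) ∷ ps) lab sound with R? i j
  ... | yes r = run-sound ps _ (merge-sound lab r sound)
  ... | no  _ = run-sound ps _ sound

  run-resp : ∀ ps lab {z w} → lab z ≡ lab w → run ps lab z ≡ run ps lab w
  run-resp []             lab eq = eq
  run-resp ((i , j) ∷ ps) lab eq with R? i j
  ... | yes _ = run-resp ps _ (cong (relabel (lab i) (lab j)) eq)
  ... | no  _ = run-resp ps _ eq

  merge-joins : ∀ i j lab → merge i j lab i ≡ merge i j lab j
  merge-joins i j lab with lab i ≟A lab j | lab j ≟A lab j
  ... | _     | no j≢j = ⊥-elim (j≢j refl)
  ... | yes _ | yes _  = refl
  ... | no  _ | yes _  = refl

  run-joins : ∀ ps lab {i j} → (i , j) ∈ ps → R i j → run ps lab i ≡ run ps lab j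
  run-joins ((i , j) ∷ ps) lab (here refl) r with R? i j
  ... | yes _ = run-resp ps _ (merge-joins i j lab)
  ... | no ¬r = ⊥-elim (¬r r)
  run-joins (_ ∷ ps) lab (there m) r = run-joins ps _ m r

  components : (ps : List (A × A)) →
    Σ[ lab ∈ Labelling ] (∀ {i j} → (i , j) ∈ ps → R i j → lab i ≡ lab j) × Sound lab
  components ps = run ps id , run-joins ps id , run-sound ps id (λ { a .a refl → ε })

module FiniteCategory (J : Cat) (fin : IsFinite J) where

  private
    N : ℕ
    N = proj₁ (proj₁ fin)
    enum : Obj J ↔ Fin N
    enum = proj₂ (proj₁ fin)
    code : Obj J → Fin N
    code = Inverse.to enum
    object : Fin N → Obj J
    object = Inverse.from enum
    object-code : ∀ a → object (code a) ≡ a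
    object-code = Inverse.strictlyInverseʳ enum

  _≟Obj_ : DecidableEquality (Obj J)
  a ≟Obj b = map′ (λ eq → trans (sym (object-code a)) (trans (cong object eq) (object-code b)))
                  (cong code) (code a ≟ code b)

  anyObj? : ∀ {Q : Obj J → Set} → (∀ a → Dec (Q a)) → Dec (Σ (Obj J) Q)
  anyObj? {Q} Q? = map′ (λ { (i , q) → object i , q })
                        (λ { (a , q) → code a , subst Q (sym (object-code a)) q })
                        (any? (Q? ∘ object))

  Hom? : ∀ a b → Dec (Hom J a b)
  Hom? a b with proj₂ fin a b
  ... | zero  , enumHom = no (¬Fin0 ∘ Inverse.to enumHom)
  ... | suc _ , enumHom = yes (Inverse.from enumHom zero)

  objects : List (Obj J)
  objects = map object (allFin N)

  ∈-objects : ∀ a → a ∈ objects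
  ∈-objects a = subst (_∈ objects) (object-code a) (∈-map⁺ object (∈-allFin (code a)))

Dec-↔-Fin : ∀ {A : Set} → Irrelevant A → (d : Dec A) →
            Σ ℕ λ k → A ↔ Fin k
Dec-↔-Fin irr (yes a) = 1 , mk↔ₛ′ (λ _ → zero) (λ _ → a) (λ { zero → refl }) (irr a)
Dec-↔-Fin irr (no ¬a) = 0 , mk↔ₛ′ (⊥-elim ∘ ¬a) (λ ()) (λ ()) (⊥-elim ∘ ¬a)

Fin-≡-↔-Fin : ∀ {m} (v w : Fin m) → Σ ℕ λ k → (v ≡ w) ↔ Fin k
Fin-≡-↔-Fin v w = Dec-↔-Fin (Decidable⇒UIP.≡-irrelevant _≟_) (v ≟ w)

module _ (G : FinGraph) where

  private
    _⊎ᶠ_ : ∀ {A B : Set} → Σ ℕ (λ k → A ↔ Fin k) → Σ ℕ (λ k → B ↔ Fin k) →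
           Σ ℕ (λ k → (A ⊎ B) ↔ Fin k)
    (k , A↔) ⊎ᶠ (l , B↔) = k + l , ↔-trans (A↔ ⊎-↔ B↔) (↔-sym +↔⊎)

  ElObj↔ : ElObj G ↔ (Fin (nV G) ⊎ Fin (nE G))
  ElObj↔ = mk↔ₛ′ (λ { (vtx v) → inj₁ v ; (edg e) → inj₂ e })
                 (λ { (inj₁ v) → vtx v ; (inj₂ e) → edg e })
                 (λ { (inj₁ _) → refl ; (inj₂ _) → refl })
                 (λ { (vtx _) → refl ; (edg _) → refl })

  vtx-edg↔ : ∀ v e → ElHom G (vtx v) (edg e) ↔ ((src G e ≡ v) ⊎ (tgt G e ≡ v))
  vtx-edg↔ v e = mk↔ₛ′ to from to-from from-to
    where
    to : ∀ {v e} → ElHom G (vtx v) (edg e) → (src G e ≡ v) ⊎ (tgt G e ≡ v)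
    to (s11M _) = inj₁ refl
    to (s10M _) = inj₂ refl
    from : ∀ {v e} → (src G e ≡ v) ⊎ (tgt G e ≡ v) → ElHom G (vtx v) (edg e)
    from {e = e} (inj₁ refl) = s11M e
    from {e = e} (inj₂ refl) = s10M e
    to-from : ∀ {v e} (y : (src G e ≡ v) ⊎ (tgt G e ≡ v)) → to (from y) ≡ y
    to-from (inj₁ refl) = refl
    to-from (inj₂ refl) = refl
    from-to : ∀ {v e} (f : ElHom G (vtx v) (edg e)) → from (to f) ≡ f
    from-to (s11M _) = refl
    from-to (s10M _) = refl

  homsFinite : ∀ a b → Σ ℕ (λ k → ElHom G a b ↔ Fin k)
  homsFinite (vtx v) (vtx w) = let k , ↔k = Fin-≡-↔-Fin v w in
    k , ↔-trans (mk↔ₛ′ (λ { (idV _) → refl }) (λ { refl → idV v })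
                       (λ { refl → refl }) (λ { (idV _) → refl })) ↔k
  homsFinite (edg e) (edg f) = let k , ↔k = Fin-≡-↔-Fin e f in
    k , ↔-trans (mk↔ₛ′ (λ { (idE _) → refl }) (λ { refl → idE e })
                       (λ { refl → refl }) (λ { (idE _) → refl })) ↔k
  homsFinite (edg e) (vtx v) = 0 , mk↔ₛ′ (λ ()) (λ ()) (λ ()) (λ ())
  homsFinite (vtx v) (edg e) = let k , ↔k = Fin-≡-↔-Fin (src G e) v ⊎ᶠ Fin-≡-↔-Fin (tgt G e) v in
    k , ↔-trans (vtx-edg↔ v e) ↔k

  El-finite : IsFinite (El G)
  El-finite = (_ , ↔-trans ElObj↔ (↔-sym +↔⊎)) , homsFinite

module ListGraph (n : ℕ) {T : Set} (edges : List T) (ends : T → Pair n) where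

  edgeAt : Fin (length edges) → Pair n
  edgeAt e = ends (lookup edges e)

  graph : FinGraph
  graph = record { nV = n ; nE = length edges ; src = lower ∘ edgeAt ; tgt = upper ∘ edgeAt }

  legs : ∀ a → Inc (elOb graph a) n
  legs (vtx v) = point v
  legs (edg e) = edgeMap (edgeAt e)

  legs-comm : ∀ {a b} (f : ElHom graph a b) → legs b ∘I elHom graph f ≈ legs a
  legs-comm (idV _)  i    = refl
  legs-comm (idE _)  i    = refl
  legs-comm (s11M _) zero = refl
  legs-comm (s10M _) zero = refl

  cocone : Cocone (IπG graph)
  cocone = record { apex = n ; leg = legs ; comm = legs-comm }

  EdgeIncreasing : ∀ {m} → (Fin n → Fin m) → Set
  EdgeIncreasing f = ∀ e → f (lower (edgeAt e)) Fin.< f (upper (edgeAt e))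

  -- A cocone over the graph is a vertex map increasing along the edges,
  -- so the tautological cocone is a colimit as soon as every such map is
  -- a morphism of 𝓛.
  isColimit : (∀ {m} (f : Fin n → Fin m) → EdgeIncreasing f →
                Σ (Inc n m) (λ u → ∀ i → fun u i ≡ f i)) →
              IsColimit cocone
  isColimit extend K' = (u , factors) , unique
    where
    f : Fin n → Fin (apex K')
    f v = fun (leg K' (vtx v)) zero
    src≡ : ∀ e → fun (leg K' (edg e)) zero ≡ f (lower (edgeAt e))
    src≡ e = comm K' (s11M e) zero
    tgt≡ : ∀ e → fun (leg K' (edg e)) (suc zero) ≡ f (upper (edgeAt e))
    tgt≡ e = comm K' (s10M e) zero
    increasing : EdgeIncreasing f
    increasing e = subst₂ Fin._<_ (src≡ e) (tgt≡ e) (mono (leg K' (edg e)) (s≤s z≤n))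
    u : Inc n (apex K')
    u = proj₁ (extend f increasing)
    u≡f : ∀ i → fun u i ≡ f i
    u≡f = proj₂ (extend f increasing)
    factors : ∀ a → u ∘I legs a ≈ leg K' a
    factors (vtx v) zero       = u≡f v
    factors (edg e) zero       = trans (u≡f _) (sym (src≡ e))
    factors (edg e) (suc zero) = trans (u≡f _) (sym (tgt≡ e))
    unique : ∀ (u w : Inc n (apex K')) → (∀ a → u ∘I legs a ≈ leg K' a) →
             (∀ a → w ∘I legs a ≈ leg K' a) → u ≈ w
    unique u w hu hw i = trans (hu (vtx i) zero) (sym (hw (vtx i) zero))

  module Amalgamation (P : Presheaf) (amalgamate : UniqueAmalgamation P cocone) where

    glue : (xv : Fin n → F₀ P 1) (xe : Fin (length edges) → F₀ P 2) →
           (∀ e → F₁ P (s 1 (suc zero)) (xe e) ≡ xv (lower (edgeAt e))) →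
           (∀ e → F₁ P (s 1 zero) (xe e) ≡ xv (upper (edgeAt e))) →
           Σ[ z ∈ F₀ P n ] (∀ v → F₁ P (point v) z ≡ xv v)
                         × (∀ e → F₁ P (edgeMap (edgeAt e)) z ≡ xe e)
    glue xv xe src-compatible tgt-compatible =
      z , (λ v → restricts (vtx v)) , (λ e → restricts (edg e))
      where
      x : ∀ a → F₀ P (elOb graph a)
      x (vtx v) = xv v
      x (edg e) = xe e
      compatible : Compatible P {D = IπG graph} x
      compatible (idV _)  = F-id P _
      compatible (idE _)  = F-id P _
      compatible (s11M e) = src-compatible e
      compatible (s10M e) = tgt-compatible e
      z : F₀ P n
      z = proj₁ (proj₁ (amalgamate x compatible))
      restricts : Restricts P cocone z x
      restricts = proj₂ (proj₁ (amalgamate x compatible))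

    detect : ∀ z z' → (∀ v → F₁ P (point v) z ≡ F₁ P (point v) z') →
             (∀ e → F₁ P (edgeMap (edgeAt e)) z ≡ F₁ P (edgeMap (edgeAt e)) z') → z ≡ z'
    detect z z' at-points at-edges = restrictions-injective P cocone amalgamate z z'
      λ { (vtx v) → at-points v ; (edg e) → at-edges e }

position : ∀ {A : Set} {x : A} {xs : List A} → x ∈ xs → Σ[ e ∈ Fin (length xs) ] lookup xs e ≡ x
position x∈xs = index x∈xs , sym (lookup-index x∈xs)

-- The complete graph on [k]: its cocone is a colimit, since a map
-- increasing along all pairs is increasing.
module Complete (k : ℕ) where
  open ListGraph k (pairs k) id public

  complete-isColimit : IsColimit cocone
  complete-isColimit = isColimit λ f increasing →
    record { fun = f ; mono = λ {i} {j} i<j → along increasing (i , j , i<j) } , λ i → refl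
    where
    along : ∀ {m} {f : Fin k → Fin m} → EdgeIncreasing f → (t : Pair k) → f (lower t) Fin.< f (upper t)
    along {f = f} increasing t = let e , e↦t = position (∈-pairs t) in
      subst (λ t → f (lower t) Fin.< f (upper t)) e↦t (increasing e)

complete-detect : (P : Presheaf) (k : ℕ) → SendsToLimit P (Complete.cocone k) →
  ∀ z z' → (∀ p → F₁ P (point p) z ≡ F₁ P (point p) z') →
           (∀ t → F₁ P (edgeMap t) z ≡ F₁ P (edgeMap t) z') → z ≡ z'
complete-detect P k lim z z' at-points at-pairs =
  detect z z' at-points (λ e → at-pairs (edgeAt e))
  where open Complete k
        open Amalgamation P (limit⇒amalgamation P cocone lim)

-- Colimits of finite diagrams

SendsGraphColimitsToLimits : Presheaf → Set₁
SendsGraphColimitsToLimits P =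
  (G : FinGraph) (K : Cocone (IπG G)) → IsColimit K → SendsToLimit P K

module FiniteColimit (P : Presheaf) (graphs : SendsGraphColimitsToLimits P)
                     (J : Cat) (fin : IsFinite J)
                     {D : Diagram J} (K : Cocone D) (colim : IsColimit K) where
  open FiniteCategory J fin
  open ColimitFacts K colim

  private
    n : ℕ
    n = apex K
    L : ∀ a → Inc (ob D a) n
    L = leg K

  cover : ∀ v → Σ (Obj J) (Hits v)
  cover v with anyObj? (hits? v)
  ... | yes hit = hit
  ... | no ¬hit = ⊥-elim (every-point-hit v (λ a h → ¬hit (a , h)))

  Linked : Fin n → Obj J → Obj J → Set
  Linked v a b = Hits v a × Hom J a b

  -- The objects hitting v are connected by such morphisms: label the
  -- components of Linked v by union–find and separate by the labels.
  hits-connected : ∀ v {a b} → Hits v a → Hits v b → EqClosure (Linked v) a b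
  hits-connected v {a} {b} ha hb =
    sound a b (separate v (λ c → lab a ≡ lab c) (λ c → lab a ≟Obj lab c) invariant ha hb refl)
    where
    open UnionFind _≟Obj_ (Linked v) (λ c d → hits? v c ×-dec Hom? c d)
    candidates : List (Obj J × Obj J)
    candidates = cartesianProduct objects objects
    lab : Labelling
    lab = proj₁ (components candidates)
    joins : ∀ {c d} → (c , d) ∈ candidates → Linked v c d → lab c ≡ lab d
    joins = proj₁ (proj₂ (components candidates))
    sound : Sound lab
    sound = proj₂ (proj₂ (components candidates))
    invariant : ∀ {c d} → Hom J c d → Hits v c →
                (lab a ≡ lab c → lab a ≡ lab d) × (lab a ≡ lab d → lab a ≡ lab c)
    invariant {c} {d} f hc = (λ eq → trans eq c~d) , (λ eq → trans eq (sym c~d))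
      where
      c~d : lab c ≡ lab d
      c~d = joins (∈-cartesianProduct⁺ (∈-objects c) (∈-objects d)) (hc , f)

  -- The graph G_D: vertices [n], and an edge for each pair in each object
  -- of D, mapped into [n] by the corresponding leg.
  Edge : Set
  Edge = Σ (Obj J) (Pair ∘ ob D)

  edgesD : List Edge
  edgesD = concatMap (λ a → map (a ,_) (pairs (ob D a))) objects

  ∈-edgesD : ∀ a t → (a , t) ∈ edgesD
  ∈-edgesD a t = ∈-concatMap⁺ _ (Any.map (λ { refl → ∈-map⁺ (a ,_) (∈-pairs t) }) (∈-objects a))

  imageOf : Edge → Pair n
  imageOf (a , t) = mapPair (L a) t

  module GD = ListGraph n edgesD imageOf

  -- G_D has colimit n: a vertex map increasing along the edges of G_D is
  -- increasing on the image of each leg, hence gives a cocone over D.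
  graphD-isColimit : IsColimit GD.cocone
  graphD-isColimit = GD.isColimit extend
    where
    extend : ∀ {m} (f : Fin n → Fin m) → GD.EdgeIncreasing f → Σ (Inc n m) (λ u → ∀ i → fun u i ≡ f i)
    extend {m} f increasing = proj₁ mediator , mediator≡f
      where
      monotone : ∀ a {p q} → p Fin.< q → f (fun (L a) p) Fin.< f (fun (L a) q)
      monotone a {p} {q} p<q = let e , e↦pq = position (∈-edgesD a (p , q , p<q)) in
        subst (λ ε → f (lower (imageOf ε)) Fin.< f (upper (imageOf ε))) e↦pq (increasing e)
      Kf : Cocone D
      Kf = record { apex = m
                  ; leg = λ a → record { fun = f ∘ fun (L a) ; mono = monotone a }
                  ; comm = λ g r → cong f (comm K g r) }
      mediator : Σ (Inc n m) (λ u → ∀ a → u ∘I L a ≈ leg Kf a)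
      mediator = proj₁ (colim Kf)
      mediator≡f : ∀ i → fun (proj₁ mediator) i ≡ f i
      mediator≡f i with cover i
      ... | a , p , refl = proj₂ mediator a p

  open GD.Amalgamation P (limit⇒amalgamation P GD.cocone (graphs GD.graph GD.cocone graphD-isColimit))

  module _ (x : ∀ a → F₀ P (ob D a)) (compatible : Compatible P {D = D} x) where

    valueAt : ∀ {v a} → Hits v a → F₀ P 1
    valueAt {a = a} (p , _) = F₁ P (point p) (x a)

    valueAt-hom : ∀ {v a b} (f : Hom J a b) (ha : Hits v a) (hb : Hits v b) → valueAt ha ≡ valueAt hb
    valueAt-hom {a = a} {b} f (p , Lp≡v) (q , Lq≡v) = begin
      F₁ P (point p) (x a)                  ≡⟨ cong (F₁ P (point p)) (sym (compatible f)) ⟩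
      F₁ P (point p) (F₁ P (hom D f) (x b)) ≡⟨ sym (restrict-∘ P (point p) (hom D f) (λ _ → sym fp≡q) (x b)) ⟩
      F₁ P (point q) (x b)                  ∎
      where
      open ≡-Reasoning
      fp≡q : fun (hom D f) p ≡ q
      fp≡q = Inc-injective (L b) (trans (comm K f p) (trans Lp≡v (sym Lq≡v)))

    valueAt-along : ∀ {v a b} → EqClosure (Linked v) a b →
                    (ha : Hits v a) (hb : Hits v b) → valueAt ha ≡ valueAt hb
    valueAt-along {a = a} ε ha hb = valueAt-hom (idC J a) ha hb
    valueAt-along (fwd (_ , f) ◅ path) ha hb =
      trans (valueAt-hom f ha (hits-along f ha)) (valueAt-along path (hits-along f ha) hb)
    valueAt-along (bwd (hc , f) ◅ path) ha hb =
      trans (sym (valueAt-hom f hc ha)) (valueAt-along path hc hb)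

    valueAt-unique : ∀ {v a b} (ha : Hits v a) (hb : Hits v b) → valueAt ha ≡ valueAt hb
    valueAt-unique {v} ha hb = valueAt-along (hits-connected v ha hb) ha hb

    vertexValue : Fin n → F₀ P 1
    vertexValue v = valueAt (proj₂ (cover v))

    edgeValue : Edge → F₀ P 2
    edgeValue (a , t) = F₁ P (edgeMap t) (x a)

    edge-src : ∀ ε → F₁ P (s 1 (suc zero)) (edgeValue ε) ≡ vertexValue (lower (imageOf ε))
    edge-src (a , t) =
      trans (sym (restrict-∘ P {h = point (lower t)} (s 1 (suc zero)) (edgeMap t) (λ { zero → refl }) (x a)))
            (valueAt-unique {a = a} (lower t , refl) (proj₂ (cover _)))

    edge-tgt : ∀ ε → F₁ P (s 1 zero) (edgeValue ε) ≡ vertexValue (upper (imageOf ε))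
    edge-tgt (a , t) =
      trans (sym (restrict-∘ P {h = point (upper t)} (s 1 zero) (edgeMap t) (λ { zero → refl }) (x a)))
            (valueAt-unique {a = a} (upper t , refl) (proj₂ (cover _)))

    restricts-point : ∀ {z v a} → Restricts P K z x → (ha : Hits v a) → F₁ P (point v) z ≡ valueAt ha
    restricts-point {z} {a = a} restricts (p , refl) =
      trans (restrict-∘ P (point p) (L a) (λ _ → refl) z) (cong (F₁ P (point p)) (restricts a))

    restricts-edge : ∀ {z} → Restricts P K z x → ∀ ε → F₁ P (edgeMap (imageOf ε)) z ≡ edgeValue ε
    restricts-edge {z} restricts (a , t) =
      trans (restrict-∘ P (edgeMap t) (L a) (λ { zero → refl ; (suc zero) → refl }) z)
            (cong (F₁ P (edgeMap t)) (restricts a))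

    glued : Σ[ z ∈ F₀ P n ] (∀ v → F₁ P (point v) z ≡ vertexValue v)
                          × (∀ e → F₁ P (edgeMap (GD.edgeAt e)) z ≡ edgeValue (lookup edgesD e))
    glued = glue vertexValue (edgeValue ∘ lookup edgesD)
                 (edge-src ∘ lookup edgesD) (edge-tgt ∘ lookup edgesD)
    z : F₀ P n
    z = proj₁ glued

    -- The glued element restricts to x: compare in P(ob D a) along points
    -- and pairs, which detect elements by the complete graph on ob D a.
    z-restricts : Restricts P K z x
    z-restricts a = complete-detect P k (graphs (Complete.graph k) (Complete.cocone k) (Complete.complete-isColimit k))
                      (F₁ P (L a) z) (x a) at-point at-pair
      where
      open ≡-Reasoning
      k : ℕ
      k = ob D a
      at-point : ∀ p → F₁ P (point p) (F₁ P (L a) z) ≡ F₁ P (point p) (x a)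
      at-point p = begin
        F₁ P (point p) (F₁ P (L a) z) ≡⟨ sym (restrict-∘ P (point p) (L a) (λ _ → refl) z) ⟩
        F₁ P (point (fun (L a) p)) z  ≡⟨ proj₁ (proj₂ glued) (fun (L a) p) ⟩
        vertexValue (fun (L a) p)     ≡⟨ valueAt-unique (proj₂ (cover _)) (p , refl) ⟩
        F₁ P (point p) (x a)          ∎
      at-pair : ∀ t → F₁ P (edgeMap t) (F₁ P (L a) z) ≡ F₁ P (edgeMap t) (x a)
      at-pair t = let e , e↦at = position (∈-edgesD a t) in begin
        F₁ P (edgeMap t) (F₁ P (L a) z) ≡⟨ sym (restrict-∘ P (edgeMap t) (L a) (λ { zero → refl ; (suc zero) → refl }) z) ⟩
        F₁ P (edgeMap (imageOf (a , t))) z ≡⟨ cong (λ ε → F₁ P (edgeMap (imageOf ε)) z) (sym e↦at) ⟩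
        F₁ P (edgeMap (GD.edgeAt e)) z  ≡⟨ proj₂ (proj₂ glued) e ⟩
        edgeValue (lookup edgesD e)     ≡⟨ cong edgeValue e↦at ⟩
        edgeValue (a , t)               ∎

    z-unique : ∀ z z' → Restricts P K z x → Restricts P K z' x → z ≡ z'
    z-unique z z' hz hz' = detect z z'
      (λ v → trans (restricts-point hz (proj₂ (cover v))) (sym (restricts-point hz' (proj₂ (cover v)))))
      (λ e → trans (restricts-edge hz (lookup edgesD e)) (sym (restricts-edge hz' (lookup edgesD e))))

  sends-to-limit : SendsToLimit P K
  sends-to-limit = amalgamation⇒limit P K λ x compatible →
    (z x compatible , z-restricts x compatible) , z-unique x compatible

lemma11 : (P : Presheaf) →
    PreservesFiniteLimits P ⇔
      ((G : FinGraph) (K : Cocone (IπG G)) → IsColimit K → SendsToLimit P K)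
lemma11 P = mk⇔
  (λ preserves G K colim → preserves (El G) (El-finite G) (IπG G) K colim)
  (λ graphs J fin D K colim → FiniteColimit.sends-to-limit P graphs J fin K colim)
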